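{- Let $(V,\in)$ be an $\in$-structure, $A:\mathsf{Type}$ and $k\in\{ -1,0,1,\dots\}\cup\{\infty\}$. Suppose $(V,\in)$ has $(k+1)$-replacement and that $A$ has an internalisation, i.e. there is $a:V$ with $\mathrm{El}\,a\simeq A$. Then every $k$-truncated map $f:A\to V$ has an internalisation: there is $b:V$ such that $z\in b\simeq\mathrm{fib}\,f\,z$ for all $z:V$.
   Context: Homotopy type theory with univalent universes and function extensionality; $\|-\|_j$ is $j$-truncation, with $\|P\|_\infty:=P$, $\infty+1=\infty$, and every map $\infty$-truncated. An $\in$-structure is a type $V$ with $\in:V\to V\to\mathsf{Type}$ such that for all $x,y:V$ the canonical map $(x=y)\to\prod_{z:V}(z\in x\simeq z\in y)$ is an equivalence. $\mathrm{El}\,a:=\sum_{x:V}x\in a$; $\mathrm{fib}\,f\,z:=\sum_{x}f\,x=z$; a map is $k$-truncated if all its fibers are $k$-types. $(V,\in)$ has $(k+1)$-replacement if for every $a:V$ and $g:\mathrm{El}\,a\to V$ there is $c:V$ with $z\in c\simeq\big\|\sum_{x:\mathrm{El}\,a}g\,x=z\big\|_k$ for all $z:V$. -}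

{-# OPTIONS --without-K #-}
module Defs where

open import Level using (Level; _⊔_; suc; Lift)
open import Data.Product using (Σ; _,_; proj₁; proj₂)
open import Data.Unit.Polymorphic using (⊤)
open import Relation.Binary.PropositionalEquality using (_≡_; refl)

private variable ℓ ℓ' ℓ'' : Level

-- HoTT basics (identity type _≡_ of Agda --without-K is the HoTT identity type)

isContr : Set ℓ → Set ℓ
isContr A = Σ A λ c → (x : A) → c ≡ x

fib : {A : Set ℓ} {B : Set ℓ'} → (A → B) → B → Set (ℓ ⊔ ℓ')
fib {A = A} f z = Σ A λ x → f x ≡ z

isEquiv : {A : Set ℓ} {B : Set ℓ'} → (A → B) → Set (ℓ ⊔ ℓ')
isEquiv {B = B} f = (y : B) → isContr (fib f y)

_≃_ : Set ℓ → Set ℓ' → Set (ℓ ⊔ ℓ')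
A ≃ B = Σ (A → B) isEquiv

idEquiv : (A : Set ℓ) → A ≃ A
idEquiv A = (λ x → x) , λ y → (y , refl) , λ { (x , refl) → refl }

data ℕ₋₁ : Set where
  neg1 : ℕ₋₁
  S    : ℕ₋₁ → ℕ₋₁

data TLevel : Set where
  fin : ℕ₋₁ → TLevel
  ∞   : TLevel

_+1 : TLevel → TLevel
fin n +1 = fin (S n)
∞ +1 = ∞

isProp : Set ℓ → Set ℓ
isProp A = (x y : A) → x ≡ y

has-level : ℕ₋₁ → Set ℓ → Set ℓ
has-level neg1  A = isProp A
has-level (S n) A = (x y : A) → has-level n (x ≡ y)

is-type-of-level : TLevel → Set ℓ → Set ℓ
is-type-of-level (fin n) A = has-level n A
is-type-of-level ∞       A = ⊤

is-truncated-map : TLevel → {A : Set ℓ} {B : Set ℓ'} → (A → B) → Set (ℓ ⊔ ℓ')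
is-truncated-map k {B = B} f = (z : B) → is-type-of-level k (fib f z)

-- Truncations (a higher inductive type, unavailable in non-cubical Agda):
-- supplied as an operation with the standard universal property on types
-- in the universe Set ℓ.
record Truncations (ℓ : Level) : Set (suc ℓ) where
  field
    ∥_∥[_]   : Set ℓ → ℕ₋₁ → Set ℓ
    ∥∥-level : (n : ℕ₋₁) (A : Set ℓ) → has-level n (∥ A ∥[ n ])
    ∣_∣      : {n : ℕ₋₁} {A : Set ℓ} → A → ∥ A ∥[ n ]
    ∥∥-univ  : (n : ℕ₋₁) (A B : Set ℓ) → has-level n B →
               isEquiv (λ (g : ∥ A ∥[ n ] → B) → λ a → g ∣ a ∣)

trunc : {ℓ : Level} → Truncations ℓ → TLevel → Set ℓ → Set ℓ
trunc T (fin n) A = Truncations.∥_∥[_] T A n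
trunc T ∞       A = A

module _ {V : Set ℓ} (_∈_ : V → V → Set ℓ') where

  canonical : {x y : V} → x ≡ y → (z : V) → (z ∈ x) ≃ (z ∈ y)
  canonical {x} refl z = idEquiv (z ∈ x)

  is-∈-structure : Set (ℓ ⊔ ℓ')
  is-∈-structure = (x y : V) → isEquiv (canonical {x} {y})

  El : V → Set (ℓ ⊔ ℓ')
  El a = Σ V λ x → x ∈ a

-- (k+1)-replacement, using the k-truncation
has-replacement-succ : {ℓ : Level} → Truncations ℓ → (k : TLevel) →
                       (V : Set ℓ) → (V → V → Set ℓ) → Set ℓ
has-replacement-succ T k V _∈_ =
  (a : V) (g : El _∈_ a → V) →
  Σ V λ c → (z : V) → (z ∈ c) ≃ trunc T k (Σ (El _∈_ a) λ x → g x ≡ z)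

-- Replacement applied to f ∘ e, where e : El a ≃ A, yields c with z ∈ c ≃ ∥ fib (f ∘ e) z ∥_k.
-- Since e is an equivalence, fib (f ∘ e) z ≃ fib f z, which is a k-type because f is k-truncated,
-- and the k-truncation of a k-type is the type itself.
module Submission where

open import Defs
open import Level using (Level)
open import Data.Product using (Σ; _,_; proj₁; proj₂)
open import Function.Base using (id; _∘_)
open import Function.Bundles using (_↔_; mk↔ₛ′; Inverse)
open import Function.Properties.Inverse using (↔-trans)
import Function.Properties.Inverse.HalfAdjointEquivalence as HAE
open import Relation.Binary.PropositionalEquality
  using (_≡_; refl; sym; trans; cong; trans-reflʳ; trans-symˡ; cong-∘)

private
  variable
    ℓ₁ ℓ₂ ℓ₃ : Level
    A : Set ℓ₁
    B : Set ℓ₂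
    C : Set ℓ₃

fib-path : (f : A → B) {y : B} {x x' : A} (p : x ≡ x') {u : f x ≡ y} {v : f x' ≡ y} →
           u ≡ trans (cong f p) v → _≡_ {A = fib f y} (x , u) (x' , v)
fib-path f refl refl = refl

isEquiv-halfAdjoint : (e : A HAE.≃ B) → isEquiv (HAE._≃_.to e)
isEquiv-halfAdjoint e y = (from y , right-inverse-of y) , contraction y
  where
  open HAE._≃_ e
  contraction : ∀ y (w : fib to y) → (from y , right-inverse-of y) ≡ w
  contraction .(to x) (x , refl) =
    fib-path to (left-inverse-of x) (trans (sym (left-right x)) (sym (trans-reflʳ _)))

↔⇒≃ : A ↔ B → A ≃ B
↔⇒≃ e = Inverse.to e , isEquiv-halfAdjoint (HAE.↔⇒≃ e)

≃⇒↔ : A ≃ B → A ↔ B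
≃⇒↔ (f , f-equiv) = mk↔ₛ′ f from (λ y → proj₂ (proj₁ (f-equiv y)))
                               (λ x → cong proj₁ (proj₂ (f-equiv (f x)) (x , refl)))
  where
  from = λ y → proj₁ (proj₁ (f-equiv y))

≃-trans : A ≃ B → B ≃ C → A ≃ C
≃-trans e e' = ↔⇒≃ (↔-trans (≃⇒↔ e) (≃⇒↔ e'))

isEquiv⇒injective : {f : A → B} → isEquiv f → ∀ {x x'} → f x ≡ f x' → x ≡ x'
isEquiv⇒injective {f = f} f-equiv {x} {x'} p =
  cong proj₁ (trans (sym (contraction (x , p))) (contraction (x' , refl)))
  where
  contraction = proj₂ (f-equiv (f x'))

fib-∘-≃ : (e : A ≃ B) (f : B → C) (z : C) → fib (f ∘ proj₁ e) z ≃ fib f z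
fib-∘-≃ e f z = ↔⇒≃ (mk↔ₛ′ forth back forth-back back-forth)
  where
  open HAE._≃_ (HAE.↔⇒≃ (≃⇒↔ e))
  forth : fib (f ∘ to) z → fib f z
  forth (x , p) = to x , p
  back : fib f z → fib (f ∘ to) z
  back (y , q) = from y , trans (cong f (right-inverse-of y)) q
  forth-back : ∀ w → forth (back w) ≡ w
  forth-back (y , q) = fib-path f (right-inverse-of y) refl
  back-forth : ∀ w → back (forth w) ≡ w
  back-forth (x , p) = fib-path (f ∘ to) (left-inverse-of x)
    (trans (cong (λ r → trans (cong f r) p) (sym (left-right x)))
           (cong (λ r → trans r p) (sym (cong-∘ (left-inverse-of x)))))

has-level-retract : (n : ℕ₋₁) (s : A → B) (r : B → A) → (∀ x → r (s x) ≡ x) →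
                    has-level n B → has-level n A
has-level-retract neg1 s r rs B-prop x x' =
  trans (sym (rs x)) (trans (cong r (B-prop (s x) (s x'))) (rs x'))
has-level-retract (S n) s r rs B-level x x' =
  has-level-retract n (cong s) (λ q → trans (sym (rs x)) (trans (cong r q) (rs x')))
    paths-retract (B-level (s x) (s x'))
  where
  paths-retract : (p : x ≡ x') → trans (sym (rs x)) (trans (cong r (cong s p)) (rs x')) ≡ p
  paths-retract refl = trans-symˡ (rs x)

is-type-of-level-≃ : (k : TLevel) → A ≃ B → is-type-of-level k B → is-type-of-level k A
is-type-of-level-≃ (fin n) e = has-level-retract n to from strictlyInverseʳ
  where open Inverse (≃⇒↔ e)
is-type-of-level-≃ ∞       e = _

truncation-of-level-≃ : (T : Truncations ℓ₁) (n : ℕ₋₁) {B : Set ℓ₁} → has-level n B →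
                        Truncations.∥_∥[_] T B n ≃ B
truncation-of-level-≃ T n {B} B-level = ↔⇒≃ (mk↔ₛ′ elim ∣_∣ elim-β η)
  where
  open Truncations T
  elim-centre = proj₁ (∥∥-univ n B B B-level id)
  elim : ∥ B ∥[ n ] → B
  elim = proj₁ elim-centre
  elim-β : ∀ b → elim ∣ b ∣ ≡ b
  elim-β b = cong (λ h → h b) (proj₂ elim-centre)
  -- ∣_∣ ∘ elim and id both extend ∣_∣, so they agree by the universal property.
  η : ∀ x → ∣ elim x ∣ ≡ x
  η x = cong (λ h → h x)
    (isEquiv⇒injective (∥∥-univ n B ∥ B ∥[ n ] (∥∥-level n B))
                       (cong (λ h → ∣_∣ ∘ h) (proj₂ elim-centre)))

trunc-of-level-≃ : (T : Truncations ℓ₁) (k : TLevel) {B : Set ℓ₁} → is-type-of-level k B →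
                   trunc T k B ≃ B
trunc-of-level-≃ T (fin n) = truncation-of-level-≃ T n
trunc-of-level-≃ T ∞ {B} _ = idEquiv B

mainTheorem16 : {ℓ ℓ' : Level} (T : Truncations ℓ)
                (V : Set ℓ) (_∈_ : V → V → Set ℓ) → is-∈-structure _∈_ →
                (A : Set ℓ') (k : TLevel) →
                has-replacement-succ T k V _∈_ →
                Σ V (λ a → El _∈_ a ≃ A) →
                (f : A → V) → is-truncated-map k f →
                Σ V (λ b → (z : V) → (z ∈ b) ≃ fib f z)
mainTheorem16 T V _∈_ _ A k replacement (a , El-a≃A) f f-truncated = c , c-internalises
  where
  image = replacement a (f ∘ proj₁ El-a≃A)
  c = proj₁ image
  c-internalises : (z : V) → (z ∈ c) ≃ fib f z
  c-internalises z =
    ≃-trans (proj₂ image z)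
      (≃-trans (trunc-of-level-≃ T k (is-type-of-level-≃ k fib-≃ (f-truncated z))) fib-≃)
    where
    fib-≃ = fib-∘-≃ El-a≃A f z
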